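{- Let $x$ be a positive integer, let $n$ and $m$ be positive integers with $m=p_1^{s_1}p_2^{s_2}\cdots p_t^{s_t}$ (distinct primes $p_i$, $s_i\ge1$), and write $n=ab$ where $a$ is the largest divisor of $n$ with $\gcd(a,m)=1$. Then, with $k$ ranging over nonnegative integers, $$\lim_{k\to\infty} I(x,nm^k)=I(x,a)\prod_{i=1}^{t}\frac{p_i^x}{p_i^x-1}.$$
   Context: For positive integers $x,n$, $\sigma_x(n)=\sum_{d\mid n} d^x$ and $I(x,n)=\sigma_x(n)/n^x$. -}

module Defs where

open import Data.Nat as ℕ using (ℕ; zero; suc; _^_)
open import Data.Nat.Divisibility using (_∣?_)
open import Data.List using (List; filter; upTo; map; drop)
open import Data.Nat.ListAction using (sum)
open import Data.Integer using (+_)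
open import Data.Fin as F using (Fin)
open import Data.Rational using (ℚ; _/_; _*_; _-_; ∣_∣; _<_; 0ℚ; 1ℚ)
open import Data.Product using (∃)

-- divisors of n : the d in {1,…,n} with d ∣ n  (empty for n = 0)
divisors : ℕ → List ℕ
divisors n = filter (_∣? n) (drop 1 (upTo (suc n)))

σ : ℕ → ℕ → ℕ
σ x n = sum (map (λ d → d ^ x) (divisors n))

-- the rational number num/den  (den = 0 gives 0, never used with den = 0)
frac : ℕ → ℕ → ℚ
frac num zero    = 0ℚ
frac num (suc d) = (+ num) / suc d

I : ℕ → ℕ → ℚ
I x n = frac (σ x n) (n ^ x)

∏ : (t : ℕ) → (Fin t → ℚ) → ℚ
∏ zero    f = 1ℚ
∏ (suc t) f = f F.zero * ∏ t (λ i → f (F.suc i))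

_⟶_ : (ℕ → ℚ) → ℚ → Set
f ⟶ L = ∀ (ε : ℚ) → 0ℚ < ε → ∃ λ K → ∀ k → K ℕ.≤ k → ∣ f k - L ∣ < ε

prodℕ : (t : ℕ) → (Fin t → ℕ) → ℕ
prodℕ zero    f = 1
prodℕ (suc t) f = f F.zero ℕ.* prodℕ t (λ i → f (F.suc i))

module Submission where

-- Write n = a·w with w ∣ m^K (every prime factor of w divides m), so that
-- n·mᵏ = a·cₖ with cₖ = mᵏ·w coprime to a, and I(n·mᵏ) = I(a)·I(cₖ) since σ is
-- multiplicative.  For a product of prime powers M = ∏ pᵢ^eᵢ the closed form
-- (Pᵢ − 1)·σ(pᵢ^eᵢ) + 1 = Pᵢ^(eᵢ+1) shows I(M) ≤ ∏ Pᵢ/(Pᵢ − 1), and that the gap is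
-- at most t/B of the limit when every Pᵢ^(eᵢ+1) ≥ B.  Since I(d) ≤ I(d·q), the value
-- I(cₖ) is squeezed between I(mᵏ) (gap ≤ t/(k+1)) and I(m^(k+K)), so it converges
-- to ∏ Pᵢ/(Pᵢ − 1) at rate O(1/k).  All estimates are kept in ℕ with denominators
-- cleared; a single lemma turns such an estimate into convergence in ℚ.

open import Defs
open import Data.Nat using (ℕ; _*_; _^_; _≤_; _≥_; _∸_)
open import Data.Nat.Divisibility using (_∣_)
open import Data.Nat.Coprimality using (Coprime)
open import Data.Nat.Primality using (Prime)
open import Data.Fin using (Fin)
open import Data.Rational using (ℚ) renaming (_*_ to _*ℚ_)
open import Function.Definitions using (Injective)
open import Relation.Binary.PropositionalEquality using (_≡_)

open import Data.Nat
  using (zero; suc; _+_; _<_; z≤n; s≤s; NonZero; >-nonZero; >-nonZero⁻¹; ≢-nonZero; nonTrivial⇒n>1)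
open import Data.Nat.Properties
open import Data.Nat.Divisibility
  using (divides; _∣?_; ∣-refl; ∣-trans; ∣-antisym; ∣⇒≤; ∣1⇒≡1; 1∣_; 0∣⇒≡0;
         m∣m*n; *-pres-∣; *-monoʳ-∣; *-cancelʳ-∣; quotient;
         m∣n⇒n≡quotient*m)
open import Data.Nat.Coprimality
  using (coprime-divisor; coprime-/gcd; coprime?; gcd≡1⇒coprime) renaming (sym to coprime-sym)
open import Data.Nat.DivMod using (_/_; m/n*n≡m; m*[n/m]≡n)
open import Data.Nat.GCD using (gcd; gcd[m,n]≢0; gcd[m,n]∣m; gcd[m,n]∣n)
open import Data.Nat.Primality using (prime; prime⇒irreducible)
open import Data.Nat.Induction using (<-rec)
open import Data.Nat.Solver using (module +-*-Solver)
open +-*-Solver using (solve; _:=_; _:*_; _:+_; con)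
open import Data.Nat.ListAction using (sum)
open import Data.Nat.ListAction.Properties using (sum-++; sum-↭)
open import Data.List using (List; []; _∷_; _++_; map; applyUpTo; cartesianProductWith)
open import Data.List.Properties using (map-++)
open import Data.List.Membership.Propositional using (_∈_)
open import Data.List.Membership.Propositional.Properties
  using (∈-∃++; ∈-++⁺ˡ; ∈-++⁺ʳ; ∈-++⁻; ∈-map⁺; ∈-map⁻; ∈-filter⁺; ∈-filter⁻;
         ∈-applyUpTo⁺; ∈-applyUpTo⁻; ∈-cartesianProductWith⁺; ∈-cartesianProductWith⁻)
open import Data.List.Relation.Binary.Subset.Propositional using (_⊆_)
open import Data.List.Relation.Binary.Permutation.Propositional using (_↭_; ↭-refl; ↭-trans; ↭-sym; ↭-prep)
import Data.List.Relation.Binary.Permutation.Propositional.Properties as ↭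
open import Data.List.Relation.Unary.Unique.Propositional using (Unique)
import Data.List.Relation.Unary.Unique.Propositional.Properties as Unique
open import Data.List.Relation.Unary.AllPairs using ([]; _∷_)
import Data.List.Relation.Unary.All as All
open import Data.List.Relation.Unary.Any using (here; there)
import Data.Fin as Fin
import Data.Fin.Properties as Fin
open import Function using (_∘_)
import Data.Integer as ℤ
import Data.Integer.Properties as ℤ
open import Data.Integer using (-[1+_])
import Data.Rational as ℚ
import Data.Rational.Properties as ℚ
open import Data.Rational using (mkℚ)
import Data.Rational.Unnormalised as ℚᵘ
import Data.Rational.Unnormalised.Properties as ℚᵘ
open import Data.Rational.Unnormalised using (mkℚᵘ)
open import Data.Product using (∃; ∃₂; _×_; _,_; proj₁; proj₂)
open import Data.Sum using (inj₁; inj₂)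
open import Data.Empty using (⊥; ⊥-elim)
open import Relation.Nullary using (¬_; yes; no)
open import Relation.Binary.PropositionalEquality
  using (_≢_; refl; sym; trans; cong; cong₂; subst; subst₂; module ≡-Reasoning)

unique-⊆⇒↭++ : ∀ {A : Set} {xs ys : List A} → Unique xs → xs ⊆ ys →
               ∃ λ zs → ys ↭ xs ++ zs
unique-⊆⇒↭++ {xs = []}     {ys} _            _    = ys , ↭-refl
unique-⊆⇒↭++ {xs = x ∷ xs} {ys} (x∉xs ∷ xs!) x∷xs⊆ys
  with ∈-∃++ (x∷xs⊆ys (here refl))
... | before , after , refl
  with unique-⊆⇒↭++ xs! xs⊆rest
  where
  xs⊆rest : xs ⊆ before ++ after
  xs⊆rest {z} z∈xs with ∈-++⁻ before (x∷xs⊆ys (there z∈xs))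
  ... | inj₁ z∈before          = ∈-++⁺ˡ z∈before
  ... | inj₂ (here refl)       = ⊥-elim (All.lookup x∉xs z∈xs refl)
  ... | inj₂ (there z∈after)   = ∈-++⁺ʳ before z∈after
... | zs , rest↭ = zs , ↭-trans (↭.shift x before after) (↭-prep x rest↭)

sum-map-mono-⊆ : ∀ {A : Set} (f : A → ℕ) {xs ys : List A} → Unique xs → xs ⊆ ys →
                 sum (map f xs) ≤ sum (map f ys)
sum-map-mono-⊆ f {xs} {ys} xs! xs⊆ys with unique-⊆⇒↭++ xs! xs⊆ys
... | zs , ys↭ = begin
  sum (map f xs)                  ≤⟨ m≤m+n _ _ ⟩
  sum (map f xs) + sum (map f zs) ≡⟨ sum-++ (map f xs) (map f zs) ⟨
  sum (map f xs ++ map f zs)      ≡⟨ cong sum (map-++ f xs zs) ⟨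
  sum (map f (xs ++ zs))          ≡⟨ sum-↭ (↭.map⁺ f (↭-sym ys↭)) ⟩
  sum (map f ys)                  ∎
  where open ≤-Reasoning

sum-map-cong-⊆⊇ : ∀ {A : Set} (f : A → ℕ) {xs ys : List A} → Unique xs → Unique ys →
                  xs ⊆ ys → ys ⊆ xs → sum (map f xs) ≡ sum (map f ys)
sum-map-cong-⊆⊇ f xs! ys! xs⊆ys ys⊆xs =
  ≤-antisym (sum-map-mono-⊆ f xs! xs⊆ys) (sum-map-mono-⊆ f ys! ys⊆xs)

divisors-unique : ∀ n → Unique (divisors n)
divisors-unique n = Unique.filter⁺ (_∣? n) (Unique.drop⁺ 1 (Unique.upTo⁺ (suc n)))

∈-divisors⁻ : ∀ n {d} → d ∈ divisors n → 1 ≤ d × d ∣ n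
∈-divisors⁻ n d∈ with ∈-filter⁻ (_∣? n) {xs = applyUpTo suc n} d∈
... | d∈range , d∣n with ∈-applyUpTo⁻ suc d∈range
...   | _ , _ , refl = s≤s z≤n , d∣n

∈-divisors⁺ : ∀ {n d} → 1 ≤ n → d ∣ n → d ∈ divisors n
∈-divisors⁺ {n} {zero}  1≤n 0∣n = ⊥-elim (<⇒≢ 1≤n (sym (0∣⇒≡0 0∣n)))
∈-divisors⁺ {n} {suc d} 1≤n d∣n = ∈-filter⁺ (_∣? n) {xs = applyUpTo suc n}
  (∈-applyUpTo⁺ suc (∣⇒≤ {{>-nonZero 1≤n}} d∣n)) d∣n

^-positive : ∀ {m} → 1 ≤ m → ∀ e → 1 ≤ m ^ e
^-positive 1≤m zero    = ≤-refl
^-positive 1≤m (suc e) = *-mono-≤ 1≤m (^-positive 1≤m e)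

*-^-distrib : ∀ a b x → (a * b) ^ x ≡ a ^ x * b ^ x
*-^-distrib a b zero    = refl
*-^-distrib a b (suc x) = begin
  a * b * (a * b) ^ x       ≡⟨ cong (a * b *_) (*-^-distrib a b x) ⟩
  a * b * (a ^ x * b ^ x)   ≡⟨ [m*n]*[o*p]≡[m*o]*[n*p] a b (a ^ x) (b ^ x) ⟩
  a * a ^ x * (b * b ^ x)   ∎
  where open ≡-Reasoning

^-swap : ∀ p e x → (p ^ e) ^ x ≡ (p ^ x) ^ e
^-swap p e x = begin
  (p ^ e) ^ x ≡⟨ ^-*-assoc p e x ⟩
  p ^ (e * x) ≡⟨ cong (p ^_) (*-comm e x) ⟩
  p ^ (x * e) ≡⟨ ^-*-assoc p x e ⟨
  (p ^ x) ^ e ∎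
  where open ≡-Reasoning

*-positiveˡ : ∀ m {n} → 1 ≤ m * n → 1 ≤ m
*-positiveˡ zero    ()
*-positiveˡ (suc m) _ = s≤s z≤n

*-positiveʳ : ∀ m {n} → 1 ≤ m * n → 1 ≤ n
*-positiveʳ m 1≤mn = >-nonZero⁻¹ _ {{m*n≢0⇒n≢0 m {{>-nonZero 1≤mn}}}}

≢0∧≢1⇒>1 : ∀ {g} → g ≢ 0 → g ≢ 1 → 1 < g
≢0∧≢1⇒>1 {zero}        g≢0 _   = ⊥-elim (g≢0 refl)
≢0∧≢1⇒>1 {suc zero}    _   g≢1 = ⊥-elim (g≢1 refl)
≢0∧≢1⇒>1 {suc (suc g)} _   _   = s≤s (s≤s z≤n)

suc-≤-^ : ∀ {P} → 2 ≤ P → ∀ k → suc k ≤ P ^ suc k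
suc-≤-^ {P} 2≤P zero    = subst (1 ≤_) (sym (*-identityʳ P)) (≤-trans (s≤s z≤n) 2≤P)
suc-≤-^ {P} 2≤P (suc k) = begin
  suc (suc k)        ≤⟨ s≤s (m≤n+m (suc k) k) ⟩
  suc k + suc k      ≡⟨ cong (suc k +_) (+-identityʳ (suc k)) ⟨
  2 * suc k          ≤⟨ *-mono-≤ 2≤P (suc-≤-^ 2≤P k) ⟩
  P * P ^ suc k      ∎
  where open ≤-Reasoning

coprime-∣ : ∀ {u v d e} → Coprime u v → d ∣ u → e ∣ v → Coprime d e
coprime-∣ u⊥v d∣u e∣v (c∣d , c∣e) = u⊥v (∣-trans c∣d d∣u , ∣-trans c∣e e∣v)

coprime-1 : ∀ {a} → Coprime a 1
coprime-1 (_ , c∣1) = ∣1⇒≡1 c∣1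

coprime-* : ∀ {a b c} → Coprime a b → Coprime a c → Coprime a (b * c)
coprime-* a⊥b a⊥c (d∣a , d∣bc) =
  a⊥c (d∣a , coprime-divisor (coprime-∣ a⊥b d∣a ∣-refl) d∣bc)

coprime-^ : ∀ {a b} k → Coprime a b → Coprime a (b ^ k)
coprime-^ zero    a⊥b = coprime-1
coprime-^ (suc k) a⊥b = coprime-* a⊥b (coprime-^ k a⊥b)

coprime-^^ : ∀ {a b} i j → Coprime a b → Coprime (a ^ i) (b ^ j)
coprime-^^ i j a⊥b = coprime-sym (coprime-^ i (coprime-sym (coprime-^ j a⊥b)))

distinct-primes-coprime : ∀ {p q} → Prime p → Prime q → p ≢ q → Coprime p q
distinct-primes-coprime p-prime q-prime p≢q (c∣p , c∣q)
  with prime⇒irreducible p-prime c∣p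
... | inj₁ c≡1    = c≡1
... | inj₂ refl with prime⇒irreducible q-prime c∣q
...   | inj₁ c≡1 = c≡1
...   | inj₂ p≡q = ⊥-elim (p≢q p≡q)

prime-∤⇒coprime : ∀ {p z} → Prime p → ¬ (p ∣ z) → Coprime z p
prime-∤⇒coprime p-prime p∤z (c∣z , c∣p) with prime⇒irreducible p-prime c∣p
... | inj₁ c≡1 = c≡1
... | inj₂ refl = ⊥-elim (p∤z c∣z)

prime>1 : ∀ {p} → Prime p → 1 < p
prime>1 {p} (prime _) = nonTrivial⇒n>1 p

sum-^-map-* : ∀ x d ys → sum (map (_^ x) (map (d *_) ys)) ≡ d ^ x * sum (map (_^ x) ys)
sum-^-map-* x d []       = sym (*-zeroʳ (d ^ x))
sum-^-map-* x d (y ∷ ys) = begin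
  (d * y) ^ x + sum (map (_^ x) (map (d *_) ys)) ≡⟨ cong₂ _+_ (*-^-distrib d y x) (sum-^-map-* x d ys) ⟩
  d ^ x * y ^ x + d ^ x * sum (map (_^ x) ys)     ≡⟨ *-distribˡ-+ (d ^ x) (y ^ x) _ ⟨
  d ^ x * (y ^ x + sum (map (_^ x) ys))           ∎
  where open ≡-Reasoning

products : List ℕ → List ℕ → List ℕ
products = cartesianProductWith _*_

sum-^-products : ∀ x ds es →
  sum (map (_^ x) (products ds es)) ≡ sum (map (_^ x) ds) * sum (map (_^ x) es)
sum-^-products x []       es = refl
sum-^-products x (d ∷ ds) es = begin
  sum (map (_^ x) (map (d *_) es ++ products ds es))                 ≡⟨ cong sum (map-++ (_^ x) (map (d *_) es) _) ⟩
  sum (map (_^ x) (map (d *_) es) ++ map (_^ x) (products ds es))    ≡⟨ sum-++ (map (_^ x) (map (d *_) es)) _ ⟩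
  sum (map (_^ x) (map (d *_) es)) + sum (map (_^ x) (products ds es)) ≡⟨ cong₂ _+_ (sum-^-map-* x d es) (sum-^-products x ds es) ⟩
  d ^ x * S + sum (map (_^ x) ds) * S                                ≡⟨ *-distribʳ-+ S (d ^ x) _ ⟨
  (d ^ x + sum (map (_^ x) ds)) * S                                  ∎
  where
  open ≡-Reasoning
  S : ℕ
  S = sum (map (_^ x) es)

products-unique : ∀ {ds es} → Unique ds → Unique es → (∀ {d} → d ∈ ds → 1 ≤ d) →
  (∀ {d d′ e e′} → d ∈ ds → d′ ∈ ds → e ∈ es → e′ ∈ es → d * e ≡ d′ * e′ → d ≡ d′) →
  Unique (products ds es)
products-unique {[]}     _            _   _   _          = []
products-unique {d ∷ ds} {es} (d∉ds ∷ ds!) es! pos determined =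
  Unique.++⁺ (Unique.map⁺ d*-injective es!)
             (products-unique ds! es! (pos ∘ there) λ d∈ d′∈ → determined (there d∈) (there d′∈))
             disjoint
  where
  d*-injective : ∀ {e e′} → d * e ≡ d * e′ → e ≡ e′
  d*-injective = *-cancelˡ-≡ _ _ d {{>-nonZero (pos (here refl))}}
  disjoint : ∀ {z} → z ∈ map (d *_) es × z ∈ products ds es → ⊥
  disjoint (z∈left , z∈right)
    with ∈-map⁻ (d *_) z∈left | ∈-cartesianProductWith⁻ _*_ ds es z∈right
  ... | e , e∈es , refl | d′ , e′ , d′∈ds , e′∈es , de≡d′e′ =
    All.lookup d∉ds d′∈ds (determined (here refl) (there d′∈ds) e∈es e′∈es de≡d′e′)

coprime-factor-unique : ∀ {u v d d′ e e′} → Coprime u v → d ∣ u → d′ ∣ u → e ∣ v → e′ ∣ v →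
                        d * e ≡ d′ * e′ → d ≡ d′
coprime-factor-unique {d = d} {d′} {e} {e′} u⊥v d∣u d′∣u e∣v e′∣v de≡d′e′ =
  ∣-antisym (coprime-divisor (coprime-∣ u⊥v d∣u e′∣v) d∣e′d′)
            (coprime-divisor (coprime-∣ u⊥v d′∣u e∣v) d′∣ed)
  where
  d∣e′d′ : d ∣ e′ * d′
  d∣e′d′ = subst (d ∣_) (trans de≡d′e′ (*-comm d′ e′)) (m∣m*n e)
  d′∣ed : d′ ∣ e * d
  d′∣ed = subst (d′ ∣_) (trans (sym de≡d′e′) (*-comm d e)) (m∣m*n e′)

-- Every positive divisor z of u·v splits as g·q with g ∣ u and q ∣ v
-- (take g = gcd(z, u)).
∣-*-split : ∀ {u v z} → 1 ≤ z → z ∣ u * v → ∃₂ λ g q → g ∣ u × q ∣ v × z ≡ g * q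
∣-*-split {u} {v} {z} 1≤z z∣uv = g , q , gcd[m,n]∣n z u , q∣v , sym (m*[n/m]≡n g∣z)
  where
  g : ℕ
  g = gcd z u
  instance
    g≢0 : NonZero g
    g≢0 = ≢-nonZero (gcd[m,n]≢0 z u (inj₁ (n>0⇒n≢0 1≤z)))
  g∣z : g ∣ z
  g∣z = gcd[m,n]∣m z u
  q : ℕ
  q = z / g
  u′ : ℕ
  u′ = u / g
  qg∣u′vg : q * g ∣ u′ * v * g
  qg∣u′vg = subst₂ _∣_ (sym (m/n*n≡m g∣z)) uv≡u′vg z∣uv
    where
    uv≡u′vg : u * v ≡ u′ * v * g
    uv≡u′vg = trans (cong (_* v) (sym (m/n*n≡m (gcd[m,n]∣n z u))))
                    (solve 3 (λ a b c → a :* b :* c := a :* c :* b) refl u′ g v)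
  q∣v : q ∣ v
  q∣v = coprime-divisor (coprime-/gcd z u) (*-cancelʳ-∣ g qg∣u′vg)

-- σ is multiplicative: for coprime u, v the divisors of u·v are exactly the
-- products d·e of a divisor of u and a divisor of v, each arising once.
σ-multiplicative : ∀ x {u v} → 1 ≤ u → 1 ≤ v → Coprime u v → σ x (u * v) ≡ σ x u * σ x v
σ-multiplicative x {u} {v} 1≤u 1≤v u⊥v =
  trans (sum-map-cong-⊆⊇ (_^ x) (divisors-unique (u * v)) unique ⊆products products⊆)
        (sum-^-products x (divisors u) (divisors v))
  where
  unique : Unique (products (divisors u) (divisors v))
  unique = products-unique (divisors-unique u) (divisors-unique v)
    (λ d∈ → proj₁ (∈-divisors⁻ u d∈))
    (λ d∈ d′∈ e∈ e′∈ → coprime-factor-unique u⊥v (proj₂ (∈-divisors⁻ u d∈)) (proj₂ (∈-divisors⁻ u d′∈))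
                                                  (proj₂ (∈-divisors⁻ v e∈)) (proj₂ (∈-divisors⁻ v e′∈)))
  ⊆products : divisors (u * v) ⊆ products (divisors u) (divisors v)
  ⊆products z∈ = as-product (∣-*-split (proj₁ (∈-divisors⁻ (u * v) z∈)) (proj₂ (∈-divisors⁻ (u * v) z∈)))
    where
    as-product : ∀ {z} → (∃₂ λ g q → g ∣ u × q ∣ v × z ≡ g * q) → z ∈ products (divisors u) (divisors v)
    as-product (g , q , g∣u , q∣v , z≡gq) = subst (_∈ products (divisors u) (divisors v)) (sym z≡gq)
      (∈-cartesianProductWith⁺ _*_ (∈-divisors⁺ 1≤u g∣u) (∈-divisors⁺ 1≤v q∣v))
  products⊆ : products (divisors u) (divisors v) ⊆ divisors (u * v)
  products⊆ z∈ with ∈-cartesianProductWith⁻ _*_ (divisors u) (divisors v) z∈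
  ... | d , e , d∈ , e∈ , refl =
    ∈-divisors⁺ (*-mono-≤ 1≤u 1≤v) (*-pres-∣ (proj₂ (∈-divisors⁻ u d∈)) (proj₂ (∈-divisors⁻ v e∈)))

-- Multiplying by q: every q·e with e ∣ d divides d·q, so σ(d)·q^x ≤ σ(d·q),
-- i.e. I(d) ≤ I(d·q).
σ-*-lower : ∀ x d q → 1 ≤ d * q → σ x d * q ^ x ≤ σ x (d * q)
σ-*-lower x d q 1≤dq = begin
  σ x d * q ^ x                             ≡⟨ *-comm (σ x d) (q ^ x) ⟩
  q ^ x * σ x d                             ≡⟨ sum-^-map-* x q (divisors d) ⟨
  sum (map (_^ x) (map (q *_) (divisors d))) ≤⟨ sum-map-mono-⊆ (_^ x) unique ⊆divisors ⟩
  σ x (d * q)                               ∎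
  where
  open ≤-Reasoning
  instance
    q≢0 : NonZero q
    q≢0 = >-nonZero (*-positiveʳ d 1≤dq)
  unique : Unique (map (q *_) (divisors d))
  unique = Unique.map⁺ (*-cancelˡ-≡ _ _ q) (divisors-unique d)
  ⊆divisors : map (q *_) (divisors d) ⊆ divisors (d * q)
  ⊆divisors z∈ with ∈-map⁻ (q *_) z∈
  ... | e , e∈ , refl = ∈-divisors⁺ 1≤dq
    (subst (q * e ∣_) (*-comm q d) (*-monoʳ-∣ q (proj₂ (∈-divisors⁻ d e∈))))

σ-1 : ∀ x → σ x 1 ≡ 1
σ-1 x = trans (+-identityʳ (1 ^ x)) (^-zeroˡ x)

-- The divisors of p^(e+1) are 1 and p times the divisors of p^e.
σ-prime-power-step : ∀ x {p} → Prime p → ∀ e → σ x (p ^ suc e) ≡ 1 + p ^ x * σ x (p ^ e)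
σ-prime-power-step x {p} p-prime e =
  trans (sum-map-cong-⊆⊇ (_^ x) (divisors-unique (p ^ suc e)) unique ⊆list list⊆)
        (cong₂ _+_ (^-zeroˡ x) (sum-^-map-* x p (divisors (p ^ e))))
  where
  1≤p : 1 ≤ p
  1≤p = <⇒≤ (prime>1 p-prime)
  instance
    p≢0 : NonZero p
    p≢0 = >-nonZero 1≤p
  multiples : List ℕ
  multiples = map (p *_) (divisors (p ^ e))
  1∉multiples : ¬ (1 ∈ multiples)
  1∉multiples 1∈ with ∈-map⁻ (p *_) 1∈
  ... | w , w∈ , 1≡pw = <⇒≢ (*-mono-≤ (prime>1 p-prime) (proj₁ (∈-divisors⁻ (p ^ e) w∈))) 1≡pw
  unique : Unique (1 ∷ multiples)
  unique = All.tabulate (λ z∈ 1≡z → 1∉multiples (subst (_∈ multiples) (sym 1≡z) z∈))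
         ∷ Unique.map⁺ (*-cancelˡ-≡ _ _ p) (divisors-unique (p ^ e))
  ⊆list : divisors (p ^ suc e) ⊆ 1 ∷ multiples
  ⊆list {z} z∈ with ∈-divisors⁻ (p ^ suc e) z∈ | p ∣? z
  ... | _ , z∣p^e+1 | no p∤z =
    here (coprime-^ (suc e) (prime-∤⇒coprime p-prime p∤z) (∣-refl , z∣p^e+1))
  ... | _ , z∣p^e+1 | yes (divides w refl) = there (subst (_∈ multiples) (*-comm p w)
    (∈-map⁺ (p *_) (∈-divisors⁺ (^-positive 1≤p e) w∣p^e)))
    where
    w∣p^e : w ∣ p ^ e
    w∣p^e = *-cancelʳ-∣ p (subst (w * p ∣_) (*-comm p (p ^ e)) z∣p^e+1)
  list⊆ : 1 ∷ multiples ⊆ divisors (p ^ suc e)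
  list⊆ (here refl) = ∈-divisors⁺ (^-positive 1≤p (suc e)) (1∣ _)
  list⊆ (there z∈) with ∈-map⁻ (p *_) z∈
  ... | w , w∈ , refl = ∈-divisors⁺ (^-positive 1≤p (suc e)) (*-monoʳ-∣ p (proj₂ (∈-divisors⁻ (p ^ e) w∈)))

P≡1+[P∸1] : ∀ x {p} → Prime p → p ^ x ≡ suc (p ^ x ∸ 1)
P≡1+[P∸1] x p-prime =
  sym (trans (+-comm 1 _) (m∸n+n≡m (^-positive (<⇒≤ (prime>1 p-prime)) x)))

-- Closed form of σ on prime powers, cleared of the denominator P − 1 (P = p^x):
-- (P − 1)·σ(p^e) + 1 = P^(e+1).
σ-prime-power : ∀ x {p} → Prime p → ∀ e → suc ((p ^ x ∸ 1) * σ x (p ^ e)) ≡ (p ^ x) ^ suc e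
σ-prime-power x {p} p-prime zero = begin
  suc ((P ∸ 1) * σ x 1) ≡⟨ cong (λ s → suc ((P ∸ 1) * s)) (σ-1 x) ⟩
  suc ((P ∸ 1) * 1)     ≡⟨ cong suc (*-identityʳ (P ∸ 1)) ⟩
  suc (P ∸ 1)           ≡⟨ P≡1+[P∸1] x p-prime ⟨
  P                     ≡⟨ *-identityʳ P ⟨
  P * 1                 ∎
  where
  open ≡-Reasoning
  P : ℕ
  P = p ^ x
σ-prime-power x {p} p-prime (suc e) = begin
  suc (Q * σ x (p ^ suc e))  ≡⟨ cong (λ s → suc (Q * s)) (σ-prime-power-step x p-prime e) ⟩
  suc (Q * (1 + P * S))      ≡⟨ cong (λ P′ → suc (Q * (1 + P′ * S))) (P≡1+[P∸1] x p-prime) ⟩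
  suc (Q * (1 + suc Q * S))  ≡⟨ solve 2 (λ q s → con 1 :+ q :* (con 1 :+ (con 1 :+ q) :* s)
                                              := (con 1 :+ q) :* (con 1 :+ q :* s)) refl Q S ⟩
  suc Q * suc (Q * S)        ≡⟨ cong₂ _*_ (sym (P≡1+[P∸1] x p-prime)) (σ-prime-power x p-prime e) ⟩
  P * P ^ suc e              ∎
  where
  open ≡-Reasoning
  P Q S : ℕ
  P = p ^ x
  Q = P ∸ 1
  S = σ x (p ^ e)

-- Comparisons of I(c) = σ(c)/c^x with a fraction U/V, with denominators cleared:
-- I(c) ≤ U/V, and I(c) ≥ (1 − T/B)·U/V.
I-below : (x U V c : ℕ) → Set
I-below x U V c = σ x c * V ≤ U * c ^ x

I-nearly-above : (x B T U V c : ℕ) → Set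
I-nearly-above x B T U V c = B * (U * c ^ x) ≤ B * (σ x c * V) + T * (U * c ^ x)

-- Since I(d) ≤ I(d·q), an upper bound for I(d·q) is one for I(d) ...
I-below-÷ : ∀ x U V d q → 1 ≤ d → 1 ≤ q → I-below x U V (d * q) → I-below x U V d
I-below-÷ x U V d q 1≤d 1≤q bound =
  *-cancelʳ-≤ (σ x d * V) (U * d ^ x) (q ^ x) {{>-nonZero (^-positive 1≤q x)}} (begin
    σ x d * V * q ^ x    ≡⟨ solve 3 (λ s v r → s :* v :* r := s :* r :* v) refl (σ x d) V (q ^ x) ⟩
    σ x d * q ^ x * V    ≤⟨ *-monoˡ-≤ V (σ-*-lower x d q (*-mono-≤ 1≤d 1≤q)) ⟩
    σ x (d * q) * V      ≤⟨ bound ⟩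
    U * (d * q) ^ x      ≡⟨ cong (U *_) (*-^-distrib d q x) ⟩
    U * (d ^ x * q ^ x)  ≡⟨ *-assoc U (d ^ x) (q ^ x) ⟨
    U * d ^ x * q ^ x    ∎)
  where open ≤-Reasoning

-- ... and a lower bound for I(d) is one for I(d·q).
I-nearly-above-* : ∀ x B T U V d q → 1 ≤ d * q →
  I-nearly-above x B T U V d → I-nearly-above x B T U V (d * q)
I-nearly-above-* x B T U V d q 1≤dq bound = begin
  B * (U * (d * q) ^ x)                             ≡⟨ cong (λ c → B * (U * c)) (*-^-distrib d q x) ⟩
  B * (U * (d ^ x * q ^ x))                         ≡⟨ solve 4 (λ b u c r → b :* (u :* (c :* r)) := b :* (u :* c) :* r) refl B U (d ^ x) (q ^ x) ⟩
  B * (U * d ^ x) * q ^ x                           ≤⟨ *-monoˡ-≤ (q ^ x) bound ⟩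
  (B * (σ x d * V) + T * (U * d ^ x)) * q ^ x       ≡⟨ solve 7 (λ b s v t u c r → (b :* (s :* v) :+ t :* (u :* c)) :* r
                                                                := b :* (s :* r :* v) :+ t :* (u :* (c :* r))) refl B (σ x d) V T U (d ^ x) (q ^ x) ⟩
  B * (σ x d * q ^ x * V) + T * (U * (d ^ x * q ^ x)) ≤⟨ +-monoˡ-≤ _ (*-monoʳ-≤ B (*-monoˡ-≤ V (σ-*-lower x d q 1≤dq))) ⟩
  B * (σ x (d * q) * V) + T * (U * (d ^ x * q ^ x)) ≡⟨ cong (λ c → B * (σ x (d * q) * V) + T * (U * c)) (*-^-distrib d q x) ⟨
  B * (σ x (d * q) * V) + T * (U * (d * q) ^ x)     ∎
  where open ≤-Reasoning

prodℕ-cong : ∀ t {f g : Fin t → ℕ} → (∀ i → f i ≡ g i) → prodℕ t f ≡ prodℕ t g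
prodℕ-cong zero    f≡g = refl
prodℕ-cong (suc t) f≡g = cong₂ _*_ (f≡g Fin.zero) (prodℕ-cong t (f≡g ∘ Fin.suc))

prodℕ-* : ∀ t (f g : Fin t → ℕ) → prodℕ t (λ i → f i * g i) ≡ prodℕ t f * prodℕ t g
prodℕ-* zero    f g = refl
prodℕ-* (suc t) f g = trans (cong (f Fin.zero * g Fin.zero *_) (prodℕ-* t (f ∘ Fin.suc) (g ∘ Fin.suc)))
                            ([m*n]*[o*p]≡[m*o]*[n*p] (f Fin.zero) (g Fin.zero) _ _)

prodℕ-^ : ∀ t (f : Fin t → ℕ) k → prodℕ t f ^ k ≡ prodℕ t (λ i → f i ^ k)
prodℕ-^ zero    f k = ^-zeroˡ k
prodℕ-^ (suc t) f k = trans (*-^-distrib (f Fin.zero) _ k) (cong (f Fin.zero ^ k *_) (prodℕ-^ t (f ∘ Fin.suc) k))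

prodℕ-positive : ∀ t (f : Fin t → ℕ) → (∀ i → 1 ≤ f i) → 1 ≤ prodℕ t f
prodℕ-positive zero    f 1≤f = ≤-refl
prodℕ-positive (suc t) f 1≤f = *-mono-≤ (1≤f Fin.zero) (prodℕ-positive t (f ∘ Fin.suc) (1≤f ∘ Fin.suc))

prodℕ-mono : ∀ t (f g : Fin t → ℕ) → (∀ i → f i ≤ g i) → prodℕ t f ≤ prodℕ t g
prodℕ-mono zero    f g f≤g = ≤-refl
prodℕ-mono (suc t) f g f≤g = *-mono-≤ (f≤g Fin.zero) (prodℕ-mono t (f ∘ Fin.suc) (g ∘ Fin.suc) (f≤g ∘ Fin.suc))

coprime-prodℕ : ∀ {a} t (f : Fin t → ℕ) → (∀ i → Coprime a (f i)) → Coprime a (prodℕ t f)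
coprime-prodℕ zero    f a⊥f = coprime-1
coprime-prodℕ (suc t) f a⊥f = coprime-* (a⊥f Fin.zero) (coprime-prodℕ t (f ∘ Fin.suc) (a⊥f ∘ Fin.suc))

prodℕ-suc-gap : ∀ t B (V : Fin t → ℕ) → (∀ i → B ≤ suc (V i)) →
  B * prodℕ t (λ i → suc (V i)) ≤ B * prodℕ t V + t * prodℕ t (λ i → suc (V i))
prodℕ-suc-gap zero    B V B≤ = m≤m+n _ _
prodℕ-suc-gap (suc t) B V B≤ = begin
  B * (suc V₀ * R)                          ≡⟨ solve 3 (λ b u r → b :* (u :* r) := u :* (b :* r)) refl B (suc V₀) R ⟩
  suc V₀ * (B * R)                          ≤⟨ *-monoʳ-≤ (suc V₀) (prodℕ-suc-gap t B (V ∘ Fin.suc) (B≤ ∘ Fin.suc)) ⟩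
  suc V₀ * (B * Π + t * R)                  ≡⟨ solve 5 (λ v b q t r → (con 1 :+ v) :* (b :* q :+ t :* r)
                                                 := b :* (v :* q) :+ b :* q :+ t :* ((con 1 :+ v) :* r)) refl V₀ B Π t R ⟩
  B * (V₀ * Π) + B * Π + t * (suc V₀ * R)   ≤⟨ +-monoˡ-≤ _ (+-monoʳ-≤ (B * (V₀ * Π)) (*-mono-≤ (B≤ Fin.zero) Π≤R)) ⟩
  B * (V₀ * Π) + suc V₀ * R + t * (suc V₀ * R) ≡⟨ +-assoc (B * (V₀ * Π)) _ _ ⟩
  B * (V₀ * Π) + suc t * (suc V₀ * R)       ∎
  where
  open ≤-Reasoning
  V₀ R Π : ℕ
  V₀ = V Fin.zero
  R = prodℕ t (λ i → suc (V (Fin.suc i)))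
  Π = prodℕ t (V ∘ Fin.suc)
  Π≤R : Π ≤ R
  Π≤R = prodℕ-mono t _ _ (λ i → n≤1+n _)

σ-prodℕ : ∀ x t (p e : Fin t → ℕ) → (∀ i → Prime (p i)) → Injective _≡_ _≡_ p →
  σ x (prodℕ t (λ i → p i ^ e i)) ≡ prodℕ t (λ i → σ x (p i ^ e i))
σ-prodℕ x zero    p e p-prime p-injective = σ-1 x
σ-prodℕ x (suc t) p e p-prime p-injective = begin
  σ x (p₀ ^ e Fin.zero * rest)                ≡⟨ σ-multiplicative x (^-positive (1≤p Fin.zero) (e Fin.zero)) 1≤rest head⊥rest ⟩
  σ x (p₀ ^ e Fin.zero) * σ x rest            ≡⟨ cong (σ x (p₀ ^ e Fin.zero) *_)
                                                  (σ-prodℕ x t (p ∘ Fin.suc) (e ∘ Fin.suc) (p-prime ∘ Fin.suc)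
                                                           (Fin.suc-injective ∘ p-injective)) ⟩
  σ x (p₀ ^ e Fin.zero) * prodℕ t (λ i → σ x (p (Fin.suc i) ^ e (Fin.suc i))) ∎
  where
  open ≡-Reasoning
  p₀ rest : ℕ
  p₀ = p Fin.zero
  rest = prodℕ t (λ i → p (Fin.suc i) ^ e (Fin.suc i))
  1≤p : ∀ i → 1 ≤ p i
  1≤p i = <⇒≤ (prime>1 (p-prime i))
  1≤rest : 1 ≤ rest
  1≤rest = prodℕ-positive t _ (λ i → ^-positive (1≤p (Fin.suc i)) (e (Fin.suc i)))
  head⊥rest : Coprime (p₀ ^ e Fin.zero) rest
  head⊥rest = coprime-prodℕ t _ λ i → coprime-^^ (e Fin.zero) (e (Fin.suc i))
    (distinct-primes-coprime (p-prime Fin.zero) (p-prime (Fin.suc i)) (λ p₀≡pᵢ → 0≢suc (p-injective p₀≡pᵢ)))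
    where
    0≢suc : ∀ {i} → Fin.zero {t} ≢ Fin.suc i
    0≢suc ()

module PrimeProducts (x t : ℕ) (p : Fin t → ℕ) (p-prime : ∀ i → Prime (p i))
                     (p-injective : Injective _≡_ _≡_ p) (x≥1 : x ≥ 1) where

  P Q : Fin t → ℕ
  P i = p i ^ x
  Q i = P i ∸ 1

  -- ΠP/ΠQ = ∏ Pᵢ/(Pᵢ − 1) is the limit in the theorem.
  ΠP ΠQ : ℕ
  ΠP = prodℕ t P
  ΠQ = prodℕ t Q

  P≥2 : ∀ i → 2 ≤ P i
  P≥2 i = ≤-trans (prime>1 (p-prime i))
    (subst (_≤ P i) (*-identityʳ (p i)) (^-monoʳ-≤ (p i) {{>-nonZero (<⇒≤ (prime>1 (p-prime i)))}} x≥1))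

  Q≥1 : ∀ i → 1 ≤ Q i
  Q≥1 i = ∸-monoˡ-≤ 1 (P≥2 i)

  ΠQ≥1 : 1 ≤ ΠQ
  ΠQ≥1 = prodℕ-positive t Q Q≥1

  -- For M = ∏ pᵢ^eᵢ and Vᵢ = Qᵢ·σ(pᵢ^eᵢ), the closed form of σ on prime powers gives
  -- σ(M)·ΠQ = ∏ Vᵢ and ΠP·M^x = ∏ (1 + Vᵢ).
  module _ (e : Fin t → ℕ) where

    V : Fin t → ℕ
    V i = Q i * σ x (p i ^ e i)

    σ*ΠQ≡ : σ x (prodℕ t (λ i → p i ^ e i)) * ΠQ ≡ prodℕ t V
    σ*ΠQ≡ = begin
      σ x (prodℕ t (λ i → p i ^ e i)) * ΠQ       ≡⟨ cong (_* ΠQ) (σ-prodℕ x t p e p-prime p-injective) ⟩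
      prodℕ t (λ i → σ x (p i ^ e i)) * ΠQ        ≡⟨ *-comm _ ΠQ ⟩
      ΠQ * prodℕ t (λ i → σ x (p i ^ e i))        ≡⟨ prodℕ-* t Q (λ i → σ x (p i ^ e i)) ⟨
      prodℕ t V                                   ∎
      where open ≡-Reasoning

    ΠP*^x≡ : ΠP * prodℕ t (λ i → p i ^ e i) ^ x ≡ prodℕ t (λ i → suc (V i))
    ΠP*^x≡ = begin
      ΠP * prodℕ t (λ i → p i ^ e i) ^ x          ≡⟨ cong (ΠP *_) (prodℕ-^ t _ x) ⟩
      ΠP * prodℕ t (λ i → (p i ^ e i) ^ x)        ≡⟨ prodℕ-* t P _ ⟨
      prodℕ t (λ i → P i * (p i ^ e i) ^ x)       ≡⟨ prodℕ-cong t (λ i → trans (cong (P i *_) (^-swap (p i) (e i) x))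
                                                                      (sym (σ-prime-power x (p-prime i) (e i)))) ⟩
      prodℕ t (λ i → suc (V i))                   ∎
      where open ≡-Reasoning

    prime-product-below : I-below x ΠP ΠQ (prodℕ t (λ i → p i ^ e i))
    prime-product-below = subst₂ _≤_ (sym σ*ΠQ≡) (sym ΠP*^x≡) (prodℕ-mono t _ _ (λ i → n≤1+n _))

    prime-product-nearly-above : ∀ B → (∀ i → B ≤ P i ^ suc (e i)) →
      I-nearly-above x B t ΠP ΠQ (prodℕ t (λ i → p i ^ e i))
    prime-product-nearly-above B B≤ =
      subst₂ _≤_ (cong (B *_) (sym ΠP*^x≡)) (cong₂ (λ u v → B * u + t * v) (sym σ*ΠQ≡) (sym ΠP*^x≡))
        (prodℕ-suc-gap t B V (λ i → subst (B ≤_) (sym (σ-prime-power x (p-prime i) (e i))) (B≤ i)))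

  module _ (s : Fin t → ℕ) where

    m : ℕ
    m = prodℕ t (λ i → p i ^ s i)

    m^≡ : ∀ j → m ^ j ≡ prodℕ t (λ i → p i ^ (s i * j))
    m^≡ j = trans (prodℕ-^ t _ j) (prodℕ-cong t (λ i → ^-*-assoc (p i) (s i) j))

    m≥1 : 1 ≤ m
    m≥1 = prodℕ-positive t _ (λ i → ^-positive (<⇒≤ (prime>1 (p-prime i))) (s i))

    -- I(mᵏ·w) ≤ I(m^(k+K)) ≤ ΠP/ΠQ.
    cofactor-below : ∀ {w K} k → w ∣ m ^ K → I-below x ΠP ΠQ (m ^ k * w)
    cofactor-below {w} {K} k w∣m^K =
      I-below-÷ x ΠP ΠQ (m ^ k * w) r (*-mono-≤ (^-positive m≥1 k) 1≤w) 1≤r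
        (subst (I-below x ΠP ΠQ) m^[k+K]≡ (prime-product-below (λ i → s i * (k + K))))
      where
      r : ℕ
      r = quotient w∣m^K
      m^K≡rw : m ^ K ≡ r * w
      m^K≡rw = m∣n⇒n≡quotient*m w∣m^K
      1≤rw : 1 ≤ r * w
      1≤rw = subst (1 ≤_) m^K≡rw (^-positive m≥1 K)
      1≤r : 1 ≤ r
      1≤r = *-positiveˡ r 1≤rw
      1≤w : 1 ≤ w
      1≤w = *-positiveʳ r 1≤rw
      m^[k+K]≡ : prodℕ t (λ i → p i ^ (s i * (k + K))) ≡ m ^ k * w * r
      m^[k+K]≡ = begin
        prodℕ t (λ i → p i ^ (s i * (k + K))) ≡⟨ m^≡ (k + K) ⟨
        m ^ (k + K)                           ≡⟨ ^-distribˡ-+-* m k K ⟩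
        m ^ k * m ^ K                         ≡⟨ cong (m ^ k *_) m^K≡rw ⟩
        m ^ k * (r * w)                       ≡⟨ solve 3 (λ a r w → a :* (r :* w) := a :* w :* r) refl (m ^ k) r w ⟩
        m ^ k * w * r                         ∎
        where open ≡-Reasoning

    -- I(mᵏ·w) ≥ I(mᵏ) ≥ (1 − t/(k+1))·ΠP/ΠQ, as Pᵢ^(sᵢk+1) ≥ Pᵢ^(k+1) ≥ k + 1.
    cofactor-nearly-above : (∀ i → s i ≥ 1) → ∀ {w} k → 1 ≤ w →
      I-nearly-above x (suc k) t ΠP ΠQ (m ^ k * w)
    cofactor-nearly-above s≥1 {w} k 1≤w =
      I-nearly-above-* x (suc k) t ΠP ΠQ (m ^ k) w (*-mono-≤ (^-positive m≥1 k) 1≤w)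
        (subst (I-nearly-above x (suc k) t ΠP ΠQ) (sym (m^≡ k))
          (prime-product-nearly-above (λ i → s i * k) (suc k) suc-k≤))
      where
      suc-k≤ : ∀ i → suc k ≤ P i ^ suc (s i * k)
      suc-k≤ i = ≤-trans (suc-≤-^ (P≥2 i) k)
        (^-monoʳ-≤ (P i) {{>-nonZero (≤-trans (s≤s z≤n) (P≥2 i))}} (s≤s (m≤n*m k (s i) {{>-nonZero (s≥1 i)}})))

CoprimeSplit : ℕ → ℕ → Set
CoprimeSplit m n = ∃ λ u → ∃₂ λ w K → n ≡ u * w × w ∣ m ^ K × Coprime u m

-- Every n ≥ 1 has such a splitting: while g = gcd(n, m) > 1, divide it out and
-- recurse on n/g < n.
coprime-split : ∀ m n → 1 ≤ n → CoprimeSplit m n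
coprime-split m = <-rec _ split
  where
  split : ∀ n → (∀ {n′} → n′ < n → 1 ≤ n′ → CoprimeSplit m n′) → 1 ≤ n → CoprimeSplit m n
  split n recurse 1≤n with coprime? n m | gcd[m,n]∣m n m
  ... | yes n⊥m | _ = n , 1 , 0 , sym (*-identityʳ n) , ∣-refl , n⊥m
  ... | no ¬n⊥m | divides n′ n≡n′g with recurse n′<n 1≤n′
    where
    1≤n′ : 1 ≤ n′
    1≤n′ = *-positiveˡ n′ (subst (1 ≤_) n≡n′g 1≤n)
    1<g : 1 < gcd n m
    1<g = ≢0∧≢1⇒>1 (gcd[m,n]≢0 n m (inj₁ (n>0⇒n≢0 1≤n))) (¬n⊥m ∘ gcd≡1⇒coprime)
    n′<n : n′ < n
    n′<n = subst (n′ <_) (sym n≡n′g) (m<m*n n′ (gcd n m) {{>-nonZero 1≤n′}} 1<g)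
  ... | u , w , K , n′≡uw , w∣m^K , u⊥m =
    u , w * gcd n m , suc K , n≡u[wg] , w*g∣m^[1+K] , u⊥m
    where
    n≡u[wg] : n ≡ u * (w * gcd n m)
    n≡u[wg] = trans n≡n′g (trans (cong (_* gcd n m) n′≡uw) (*-assoc u w (gcd n m)))
    w*g∣m^[1+K] : w * gcd n m ∣ m ^ suc K
    w*g∣m^[1+K] = subst (w * gcd n m ∣_) (*-comm (m ^ K) m) (*-pres-∣ w∣m^K (gcd[m,n]∣n n m))

-- If a is the largest divisor of n coprime to m, then n = a·w with w ∣ m^K:
-- the coprime part u of the split above satisfies u ≤ a by maximality and
-- a ∣ u because a is coprime to w.
maximal-coprime-divisor-split : ∀ {m n a} → 1 ≤ n → a ∣ n → Coprime a m →
  (∀ d → d ∣ n → Coprime d m → d ≤ a) → ∃₂ λ w K → n ≡ a * w × w ∣ m ^ K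
maximal-coprime-divisor-split {m} {n} {a} 1≤n a∣n a⊥m maximal
  with coprime-split m n 1≤n
... | u , w , K , n≡uw , w∣m^K , u⊥m = w , K , trans n≡uw (cong (_* w) (sym a≡u)) , w∣m^K
  where
  1≤u : 1 ≤ u
  1≤u = *-positiveˡ u (subst (1 ≤_) n≡uw 1≤n)
  a∣u : a ∣ u
  a∣u = coprime-divisor (coprime-∣ (coprime-^ K a⊥m) ∣-refl w∣m^K)
                        (subst (a ∣_) (trans n≡uw (*-comm u w)) a∣n)
  a≡u : a ≡ u
  a≡u = ≤-antisym (∣⇒≤ {{>-nonZero 1≤u}} a∣u) (maximal u (subst (u ∣_) (sym n≡uw) (m∣m*n w)) u⊥m)

-- |N₁/D₁ − N₂/D₂| < ε = num/den when N₁·D₂ + G = N₂·D₁ and G·den < num·D₁·D₂: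
-- the difference is exactly G/(D₁·D₂).  First on unnormalised rationals ...
∣-∣ᵘ-gap< : ∀ N₁ d₁ N₂ d₂ G num den → N₁ * suc d₂ + G ≡ N₂ * suc d₁ →
  G * suc den < num * (suc d₁ * suc d₂) →
  ℚᵘ.∣ mkℚᵘ (ℤ.+ N₁) d₁ ℚᵘ.- mkℚᵘ (ℤ.+ N₂) d₂ ∣ ℚᵘ.< mkℚᵘ (ℤ.+ num) den
∣-∣ᵘ-gap< N₁ d₁ N₂ d₂ G num den gap G*den< = ℚᵘ.*<* (subst₂ ℤ._<_ lhs≡ (ℤ.pos-* num (suc d₁ * suc d₂)) (ℤ.+<+ G*den<))
  where
  A : ℕ
  A = N₁ * suc d₂
  numerator≡ : ℤ.+ N₁ ℤ.* ℤ.+ suc d₂ ℤ.+ ℤ.- ℤ.+ N₂ ℤ.* ℤ.+ suc d₁ ≡ ℤ.+ A ℤ.- ℤ.+ (A + G)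
  numerator≡ = cong₂ ℤ._+_ (sym (ℤ.pos-* N₁ (suc d₂)))
    (trans (sym (ℤ.neg-distribˡ-* (ℤ.+ N₂) (ℤ.+ suc d₁)))
           (cong ℤ.-_ (trans (sym (ℤ.pos-* N₂ (suc d₁))) (cong ℤ.+_ (sym gap)))))
  ∣A-[A+G]∣≡G : ℤ.∣ ℤ.+ A ℤ.- ℤ.+ (A + G) ∣ ≡ G
  ∣A-[A+G]∣≡G = begin
    ℤ.∣ ℤ.+ A ℤ.- ℤ.+ (A + G) ∣ ≡⟨ cong ℤ.∣_∣ (ℤ.m-n≡m⊖n A (A + G)) ⟩
    ℤ.∣ A ℤ.⊖ (A + G) ∣     ≡⟨ ℤ.∣m⊖n∣≡∣n⊖m∣ A (A + G) ⟩
    ℤ.∣ (A + G) ℤ.⊖ A ∣     ≡⟨ cong ℤ.∣_∣ (ℤ.⊖-≥ (m≤m+n A G)) ⟩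
    A + G ∸ A               ≡⟨ m+n∸m≡n A G ⟩
    G                       ∎
    where open ≡-Reasoning
  lhs≡ : ℤ.+ (G * suc den) ≡ ℚᵘ.↥ ℚᵘ.∣ mkℚᵘ (ℤ.+ N₁) d₁ ℚᵘ.- mkℚᵘ (ℤ.+ N₂) d₂ ∣ ℤ.* ℤ.+ suc den
  lhs≡ = trans (ℤ.pos-* G (suc den))
    (cong (λ z → ℤ.+ z ℤ.* ℤ.+ suc den) (sym (trans (cong ℤ.∣_∣ numerator≡) ∣A-[A+G]∣≡G)))

-- ... and then for frac, which is the normalisation of the unnormalised fraction.
toℚᵘ-frac : ∀ N d → ℚ.toℚᵘ (frac N (suc d)) ℚᵘ.≃ mkℚᵘ (ℤ.+ N) d
toℚᵘ-frac N d = ℚ.toℚᵘ-fromℚᵘ (mkℚᵘ (ℤ.+ N) d)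

frac-gap< : ∀ N₁ D₁ N₂ D₂ G (ε : ℚ) → 1 ≤ D₁ → 1 ≤ D₂ → N₁ * D₂ + G ≡ N₂ * D₁ → ℚ.0ℚ ℚ.< ε →
  G * ℚ.↧ₙ ε < ℤ.∣ ℚ.↥ ε ∣ * (D₁ * D₂) → ℚ.∣ frac N₁ D₁ ℚ.- frac N₂ D₂ ∣ ℚ.< ε
frac-gap< N₁ (suc d₁) N₂ (suc d₂) G (mkℚ (ℤ.+ num) den _) _ _ gap _ G*den< =
  ℚ.toℚᵘ-cancel-< (ℚᵘ.<-respˡ-≃ (ℚᵘ.≃-sym toℚᵘ-∣-∣) (∣-∣ᵘ-gap< N₁ d₁ N₂ d₂ G num den gap G*den<))
  where
  q₁ q₂ : ℚ
  q₁ = frac N₁ (suc d₁)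
  q₂ = frac N₂ (suc d₂)
  toℚᵘ-∣-∣ : ℚ.toℚᵘ ℚ.∣ q₁ ℚ.- q₂ ∣ ℚᵘ.≃ ℚᵘ.∣ mkℚᵘ (ℤ.+ N₁) d₁ ℚᵘ.- mkℚᵘ (ℤ.+ N₂) d₂ ∣
  toℚᵘ-∣-∣ = ℚᵘ.≃-trans (ℚ.toℚᵘ-homo-∣-∣ (q₁ ℚ.- q₂)) (ℚᵘ.∣-∣-cong
    (ℚᵘ.≃-trans (ℚ.toℚᵘ-homo-+ q₁ (ℚ.- q₂)) (ℚᵘ.+-cong (toℚᵘ-frac N₁ d₁)
      (ℚᵘ.≃-trans (ℚ.toℚᵘ-homo‿- q₂) (ℚᵘ.-‿cong (toℚᵘ-frac N₂ d₂))))))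
frac-gap< N₁ (suc d₁) N₂ (suc d₂) G (mkℚ -[1+ _ ] _ _) _ _ _ (ℚ.*<* ()) _

frac-* : ∀ a b c d → 1 ≤ b → 1 ≤ d → frac a b ℚ.* frac c d ≡ frac (a * c) (b * d)
frac-* a (suc b) c (suc d) _ _ = ℚ.toℚᵘ-injective (begin-equality
  ℚ.toℚᵘ (frac a (suc b) ℚ.* frac c (suc d))         ≃⟨ ℚ.toℚᵘ-homo-* (frac a (suc b)) (frac c (suc d)) ⟩
  ℚ.toℚᵘ (frac a (suc b)) ℚᵘ.* ℚ.toℚᵘ (frac c (suc d)) ≃⟨ ℚᵘ.*-cong (toℚᵘ-frac a b) (toℚᵘ-frac c d) ⟩
  mkℚᵘ (ℤ.+ a ℤ.* ℤ.+ c) (d + b * suc d)                  ≡⟨ cong (λ z → mkℚᵘ z (d + b * suc d)) (sym (ℤ.pos-* a c)) ⟩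
  mkℚᵘ (ℤ.+ (a * c)) (d + b * suc d)                    ≃⟨ toℚᵘ-frac (a * c) (d + b * suc d) ⟨
  ℚ.toℚᵘ (frac (a * c) (suc b * suc d))               ∎)
  where open ℚᵘ.≤-Reasoning

∏-frac : ∀ t (f g : Fin t → ℕ) → (∀ i → 1 ≤ g i) → ∏ t (λ i → frac (f i) (g i)) ≡ frac (prodℕ t f) (prodℕ t g)
∏-frac zero    f g 1≤g = refl
∏-frac (suc t) f g 1≤g =
  trans (cong (frac (f Fin.zero) (g Fin.zero) ℚ.*_) (∏-frac t (f ∘ Fin.suc) (g ∘ Fin.suc) (1≤g ∘ Fin.suc)))
        (frac-* _ _ _ _ (1≤g Fin.zero) (prodℕ-positive t (g ∘ Fin.suc) (1≤g ∘ Fin.suc)))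

⟶-cong : ∀ {f g : ℕ → ℚ} {L L′ : ℚ} → (∀ k → f k ≡ g k) → L ≡ L′ → g ⟶ L′ → f ⟶ L
⟶-cong f≡g refl g⟶L ε 0<ε with g⟶L ε 0<ε
... | K , close = K , λ k K≤k → subst (λ y → ℚ.∣ y ℚ.- _ ∣ ℚ.< ε) (sym (f≡g k)) (close k K≤k)

numerator-positive : ∀ (ε : ℚ) → ℚ.0ℚ ℚ.< ε → 1 ≤ ℤ.∣ ℚ.↥ ε ∣
numerator-positive (mkℚ (ℤ.+ zero)  _ _) (ℚ.*<* (ℤ.+<+ ()))
numerator-positive (mkℚ (ℤ.+ suc _) _ _) _ = s≤s z≤n
numerator-positive (mkℚ -[1+ _ ]    _ _) (ℚ.*<* ())

converges-from-below : ∀ (N D G : ℕ → ℕ) U V R → 1 ≤ V → (∀ k → 1 ≤ D k) →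
  (∀ k → N k * V + G k ≡ U * D k) → (∀ k → suc k * G k ≤ R * D k) →
  (λ k → frac (N k) (D k)) ⟶ frac U V
converges-from-below N D G U V R 1≤V 1≤D gap rate ε 0<ε = R * den , close
  where
  den num : ℕ
  den = ℚ.↧ₙ ε
  num = ℤ.∣ ℚ.↥ ε ∣
  close : ∀ k → R * den ≤ k → ℚ.∣ frac (N k) (D k) ℚ.- frac U V ∣ ℚ.< ε
  close k R*den≤k = frac-gap< (N k) (D k) U V (G k) ε (1≤D k) 1≤V (gap k) 0<ε
    (*-cancelˡ-< (suc k) _ _ (begin-strict
      suc k * (G k * den)        ≡⟨ *-assoc (suc k) (G k) den ⟨
      suc k * G k * den          ≤⟨ *-monoˡ-≤ den (rate k) ⟩
      R * D k * den              ≡⟨ solve 3 (λ r d n → r :* d :* n := r :* n :* d) refl R (D k) den ⟩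
      R * den * D k              ≤⟨ *-monoˡ-≤ (D k) R*den≤k ⟩
      k * D k                    <⟨ m<n+m (k * D k) (1≤D k) ⟩
      suc k * D k                ≤⟨ *-monoʳ-≤ (suc k) D≤ ⟩
      suc k * (num * (D k * V))  ∎))
    where
    open ≤-Reasoning
    D≤ : D k ≤ num * (D k * V)
    D≤ = begin
      D k             ≡⟨ *-identityʳ (D k) ⟨
      D k * 1         ≤⟨ *-monoʳ-≤ (D k) 1≤V ⟩
      D k * V         ≡⟨ *-identityˡ (D k * V) ⟨
      1 * (D k * V)   ≤⟨ *-monoˡ-≤ (D k * V) (numerator-positive ε 0<ε) ⟩
      num * (D k * V) ∎

frac-squeeze : ∀ A α U V T (S C : ℕ → ℕ) → 1 ≤ α → 1 ≤ V → (∀ k → 1 ≤ C k) →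
  (∀ k → S k * V ≤ U * C k) →
  (∀ k → suc k * (U * C k) ≤ suc k * (S k * V) + T * (U * C k)) →
  (λ k → frac (A * S k) (α * C k)) ⟶ frac (A * U) (α * V)
frac-squeeze A α U V T S C 1≤α 1≤V 1≤C below nearly-above =
  converges-from-below (λ k → A * S k) (λ k → α * C k) (λ k → A * α * Δ k) (A * U) (α * V) (A * T * U)
    (*-mono-≤ 1≤α 1≤V) (λ k → *-mono-≤ 1≤α (1≤C k)) gap rate
  where
  Δ : ℕ → ℕ
  Δ k = U * C k ∸ S k * V
  SV+Δ≡UC : ∀ k → S k * V + Δ k ≡ U * C k
  SV+Δ≡UC k = m+[n∸m]≡n (below k)
  gap : ∀ k → A * S k * (α * V) + A * α * Δ k ≡ A * U * (α * C k)
  gap k = begin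
    A * S k * (α * V) + A * α * Δ k ≡⟨ solve 5 (λ a s α v d → a :* s :* (α :* v) :+ a :* α :* d
                                                := a :* α :* (s :* v :+ d)) refl A (S k) α V (Δ k) ⟩
    A * α * (S k * V + Δ k)        ≡⟨ cong (A * α *_) (SV+Δ≡UC k) ⟩
    A * α * (U * C k)              ≡⟨ solve 4 (λ a α u c → a :* α :* (u :* c) := a :* u :* (α :* c)) refl A α U (C k) ⟩
    A * U * (α * C k)              ∎
    where open ≡-Reasoning
  suc-k*Δ≤ : ∀ k → suc k * Δ k ≤ T * (U * C k)
  suc-k*Δ≤ k = +-cancelˡ-≤ (suc k * (S k * V)) _ _ (begin
    suc k * (S k * V) + suc k * Δ k ≡⟨ *-distribˡ-+ (suc k) (S k * V) (Δ k) ⟨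
    suc k * (S k * V + Δ k)         ≡⟨ cong (suc k *_) (SV+Δ≡UC k) ⟩
    suc k * (U * C k)               ≤⟨ nearly-above k ⟩
    suc k * (S k * V) + T * (U * C k) ∎)
    where open ≤-Reasoning
  rate : ∀ k → suc k * (A * α * Δ k) ≤ A * T * U * (α * C k)
  rate k = begin
    suc k * (A * α * Δ k)   ≡⟨ solve 4 (λ b a α d → b :* (a :* α :* d) := a :* α :* (b :* d)) refl (suc k) A α (Δ k) ⟩
    A * α * (suc k * Δ k)   ≤⟨ *-monoʳ-≤ (A * α) (suc-k*Δ≤ k) ⟩
    A * α * (T * (U * C k)) ≡⟨ solve 5 (λ a α t u c → a :* α :* (t :* (u :* c)) := a :* t :* u :* (α :* c)) refl A α T U (C k) ⟩
    A * T * U * (α * C k)   ∎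
    where open ≤-Reasoning

I-coprime-* : ∀ x {u v} → 1 ≤ u → 1 ≤ v → Coprime u v →
  I x (u * v) ≡ frac (σ x u * σ x v) (u ^ x * v ^ x)
I-coprime-* x {u} {v} 1≤u 1≤v u⊥v = cong₂ frac (σ-multiplicative x 1≤u 1≤v u⊥v) (*-^-distrib u v x)

mainTheorem5 : (x n m t : ℕ) → (p s : Fin t → ℕ) → (a : ℕ) →
    x ≥ 1 → n ≥ 1 → m ≥ 1 →
    (∀ i → Prime (p i)) → Injective _≡_ _≡_ p → (∀ i → s i ≥ 1) →
    m ≡ prodℕ t (λ i → p i ^ s i) →
    a ∣ n → Coprime a m → (∀ d → d ∣ n → Coprime d m → d ≤ a) →
    (λ k → I x (n * m ^ k)) ⟶
    (I x a *ℚ ∏ t (λ i → frac (p i ^ x) (p i ^ x ∸ 1)))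
mainTheorem5 x n _ t p s a x≥1 n≥1 _ p-prime p-injective s≥1 refl a∣n a⊥m maximal =
  ⟶-cong {g = λ k → frac (σ x a * σ x (c k)) (a ^ x * c k ^ x)} {L′ = frac (σ x a * ΠP) (a ^ x * ΠQ)}
    I[n·mᵏ]≡ limit≡
    (frac-squeeze (σ x a) (a ^ x) ΠP ΠQ t (λ k → σ x (c k)) (λ k → c k ^ x) (^-positive 1≤a x) ΠQ≥1
       (λ k → ^-positive (1≤c k) x) (λ k → cofactor-below s {K = K} k w∣m^K) (λ k → cofactor-nearly-above s s≥1 k 1≤w))
  where
  open PrimeProducts x t p p-prime p-injective x≥1
  split : ∃₂ λ w K → n ≡ a * w × w ∣ m s ^ K
  split = maximal-coprime-divisor-split n≥1 a∣n a⊥m maximal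
  w K : ℕ
  w = proj₁ split
  K = proj₁ (proj₂ split)
  n≡aw : n ≡ a * w
  n≡aw = proj₁ (proj₂ (proj₂ split))
  w∣m^K : w ∣ m s ^ K
  w∣m^K = proj₂ (proj₂ (proj₂ split))
  1≤a : 1 ≤ a
  1≤a = *-positiveˡ a (subst (1 ≤_) n≡aw n≥1)
  1≤w : 1 ≤ w
  1≤w = *-positiveʳ a (subst (1 ≤_) n≡aw n≥1)
  c : ℕ → ℕ
  c k = m s ^ k * w
  1≤c : ∀ k → 1 ≤ c k
  1≤c k = *-mono-≤ (^-positive (m≥1 s) k) 1≤w
  I[n·mᵏ]≡ : ∀ k → I x (n * m s ^ k) ≡ frac (σ x a * σ x (c k)) (a ^ x * c k ^ x)
  I[n·mᵏ]≡ k = trans (cong (I x) (trans (cong (_* m s ^ k) n≡aw) (solve 3 (λ a w M → a :* w :* M := a :* (M :* w)) refl a w (m s ^ k))))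
    (I-coprime-* x 1≤a (1≤c k) (coprime-* (coprime-^ k a⊥m) (coprime-∣ (coprime-^ K a⊥m) ∣-refl w∣m^K)))
  limit≡ : I x a *ℚ ∏ t (λ i → frac (P i) (Q i)) ≡ frac (σ x a * ΠP) (a ^ x * ΠQ)
  limit≡ = trans (cong (I x a *ℚ_) (∏-frac t P Q Q≥1)) (frac-* _ _ _ _ (^-positive 1≤a x) ΠQ≥1)
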